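{- Let $p\ge1$, $s,t\ge0$, $a_1,\dots,a_p,b_1,\dots,b_p\ge1$ be integers. For an integer $z$ write $z=2p\,\bar z+\hat z$ with $\bar z\in\mathbb Z$ and $0\le\hat z<2p$. The recurrence $$H(n)=H\Big(n-s-\sum_{i=1}^pH(n-a_i)\Big)+H\Big(n-t-\sum_{i=1}^pH(n-b_i)\Big)$$ is formally satisfied by the sequence $\lceil n/2p\rceil$ for all integers $n$, i.e. $$\Big\lceil\frac{n}{2p}\Big\rceil=\Big\lceil\frac{n-s-\sum_{i=1}^p\lceil (n-a_i)/2p\rceil}{2p}\Big\rceil+\Big\lceil\frac{n-t-\sum_{i=1}^p\lceil (n-b_i)/2p\rceil}{2p}\Big\rceil\quad\text{for all } n\in\mathbb Z,$$ if and only if all of the following hold: (1) for each $j\in\{0,1,\dots,p-1\}$, at most $j$ of the $\hat a_i$ satisfy $\hat a_i\le j$ and at most $j$ of them satisfy $\hat a_i\ge 2p-j$; (2) for each $j\in\{0,1,\dots,p-1\}$, at most $j$ of the $\hat b_i$ satisfy $\hat b_i\le j$ and at most $j$ of them satisfy $\hat b_i\ge 2p-j$; (3) there is an integer $d$ such that either $-s+\sum_{i=1}^p\bar a_i=2pd$ and $-t+\sum_{i=1}^p\bar b_i=-2pd-p$, or $-s+\sum_{i=1}^p\bar a_i=-2pd-p$ and $-t+\sum_{i=1}^p\bar b_i=2pd$. -}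

module Defs where

open import Data.Nat as ℕ using (ℕ; zero; suc; NonZero)
open import Data.Integer as ℤ using (ℤ; +_; -_; _+_; _-_; _*_; _/ℕ_; _%ℕ_)
open import Data.Fin using (Fin)
open import Data.Fin.Base using () renaming (toℕ to finToℕ)
import Data.Nat.Properties as ℕP
open import Relation.Binary.PropositionalEquality using (_≡_)
open import Data.Product using (_×_)
open import Data.List using (List; map; sum; length; filter; allFin)
open import Relation.Unary using (Pred; Decidable)

∑ : ∀ {p} → (Fin p → ℤ) → ℤ
∑ {p} f = Data.List.foldr _+_ (+ 0) (map f (allFin p))

countWhere : ∀ {p} {ℓ} (f : Fin p → ℕ) {P : Pred ℕ ℓ} → Decidable P → ℕ
countWhere {p} f P? = length (filter P? (map f (allFin p)))

-- ceiling division ⌈ n / m ⌉ for m > 0  (note _/ℕ_ is floor division)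
ceilDiv : ℤ → (m : ℕ) → .{{NonZero m}} → ℤ
ceilDiv n m = - ((- n) /ℕ m)

zbar : (p : ℕ) → .{{NonZero p}} → ℤ → ℤ
zbar p z = z /ℕ (2 ℕ.* p)
  where instance _ : NonZero (2 ℕ.* p)
                 _ = ℕP.m*n≢0 2 p

zhat : (p : ℕ) → .{{NonZero p}} → ℤ → ℕ
zhat p z = z %ℕ (2 ℕ.* p)
  where instance _ : NonZero (2 ℕ.* p)
                 _ = ℕP.m*n≢0 2 p

H : (p : ℕ) → .{{NonZero p}} → ℤ → ℤ
H p n = ceilDiv n (2 ℕ.* p)
  where instance _ : NonZero (2 ℕ.* p)
                 _ = ℕP.m*n≢0 2 p

Satisfies : (p : ℕ) → .{{NonZero p}} → (s t : ℕ) → (a b : Fin p → ℕ) → Set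
Satisfies p s t a b =
  ∀ (n : ℤ) → H p n ≡ H p (n - + s - ∑ (λ i → H p (n - + a i)))
                     + H p (n - + t - ∑ (λ i → H p (n - + b i)))

ResidueCond : (p : ℕ) → .{{NonZero p}} → (c : Fin p → ℕ) → Set
ResidueCond p c =
  ∀ (j : ℕ) → j ℕ.< p →
    countWhere ĉ (λ x → x ℕ.≤? j) ℕ.≤ j
    × countWhere ĉ (λ x → (2 ℕ.* p ℕ.∸ j) ℕ.≤? x) ℕ.≤ j
  where
    ĉ : Fin p → ℕ
    ĉ i = zhat p (+ c i)

module Submission where

-- Write N = 2p, P = p, n = N·k + r with 0 ≤ r < N, and c_i = N·c̄_i + ĉ_i.  Then
-- ⌈(n - c_i)/N⌉ = k - c̄_i + [ĉ_i < r], so each outer argument is P·k + A + F r with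
-- offset A = -s + ∑ c̄_i and F r = r - #{i : ĉ_i < r} (module Theory).  The recurrence
-- thus becomes `Recurrence A B F G`:  k + [r > 0] = ⌈(P·k + A + F r)/N⌉ + ⌈(P·k + B + G r)/N⌉,
-- analysed in module Core for any q with the defining properties of ⌈·/N⌉.  There the
-- key tool is `exactly-one`: if two ceilings sum to α + β + 1, exactly one argument
-- exceeds its threshold.  Moving multiples of N between A and B normalises A, B ≤ 0;
-- rows k ∈ {0, 1} at r ∈ {0, 1} then force {A, B} = {0, -P}, i.e. condition (3), and for
-- these offsets the rows at r > 0 say exactly 1 ≤ F r, G r ≤ P, which counting turns
-- into (1), (2).

open import Defs
open import Data.Nat as ℕ using (ℕ; NonZero; zero; suc)
import Data.Nat.Properties as ℕP
open import Data.Integer as ℤ using (ℤ; +_; -_; _+_; _-_; _*_; _≤_; _<_; _/ℕ_; _%ℕ_)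
import Data.Integer.Properties as ℤP
open import Data.Integer.DivMod using ([n/ℕd]*d≤n; n<s[n/ℕd]*d; a≡a%ℕn+[a/ℕn]*n; n%ℕd<d)
open import Data.Integer.Tactic.RingSolver using (solve-∀; solve)
open import Data.List using (List; []; _∷_; map; foldr; length; filter; allFin)
open import Data.List.Properties using (map-cong; length-map; length-tabulate; filter-none; filter-≐)
import Data.List.Relation.Unary.All as All
import Data.List.Relation.Unary.All.Properties as All
import Data.Nat.Tactic.RingSolver as ℕSolver
open import Data.Bool using (if_then_else_)
open import Level using (0ℓ)
open import Relation.Unary using (Pred; Decidable)
open import Relation.Binary.PropositionalEquality
open import Relation.Nullary using (¬_; Dec; does; yes; no)
open import Data.Product using (_×_; _,_; ∃; proj₁; proj₂)
open import Data.Sum using (_⊎_; inj₁; inj₂)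
open import Data.Empty using (⊥-elim; ⊥)
open import Data.Fin using (Fin)
open import Function.Bundles using (_⇔_; mk⇔; Equivalence)
open import Data.Product.Function.NonDependent.Propositional using (_×-⇔_)
import Function.Construct.Composition as Composition

-- Routine linear arithmetic over ℤ is discharged by certificates: x ≤ y holds
-- because y - x equals, by a ring identity, a sum of gaps already known to be
-- non-negative.
≤-by : ∀ {x y e} → + 0 ≤ e → y - x ≡ e → x ≤ y
≤-by 0≤e eq = ℤP.0≤i-j⇒j≤i (subst (+ 0 ≤_) (sym eq) 0≤e)

<-by : ∀ {x y e} → + 0 ≤ e → y - (+ 1 + x) ≡ e → x < y
<-by 0≤e eq = ℤP.suc[i]≤j⇒i<j (≤-by 0≤e eq)

gap : ∀ {x y} → x ≤ y → + 0 ≤ y - x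
gap = ℤP.i≤j⇒0≤j-i

strict-gap : ∀ {x y} → x < y → + 0 ≤ y - (+ 1 + x)
strict-gap x<y = gap (ℤP.i<j⇒suc[i]≤j x<y)

0≤1 : + 0 ≤ + 1
0≤1 = ℤ.+≤+ ℕ.z≤n

infixl 6 _⊕_
_⊕_ : ∀ {a b} → + 0 ≤ a → + 0 ≤ b → + 0 ≤ a + b
_⊕_ = ℤP.+-mono-≤

sum-below : ∀ {a b α β} → a ≤ α → b ≤ β → a + b < α + β + + 1
sum-below {a} {b} {α} {β} a≤α b≤β =
  <-by (gap a≤α ⊕ gap b≤β) (solve (a ∷ b ∷ α ∷ β ∷ []))

sum-above : ∀ {a b α β} → α < a → β < b → α + β + + 1 < a + b
sum-above {a} {b} {α} {β} α<a β<b =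
  <-by (strict-gap α<a ⊕ strict-gap β<b) (solve (a ∷ b ∷ α ∷ β ∷ []))

impossible : ∀ {e} {A : Set} → + 0 ≤ e → e ≡ - + 1 → A
impossible 0≤e refl with 0≤e
... | ()

≤-via : ∀ {a b c h} → a ≤ c → c - h ≤ b → a ≤ b + h
≤-via {a} {b} {c} {h} a≤c c-h≤b = ≤-by (gap a≤c ⊕ gap c-h≤b) (solve (a ∷ b ∷ c ∷ h ∷ []))

scaled-step : ∀ n .{{_ : ℤ.NonNegative n}} {a b} → n * a < n * b + n → a ≤ b
scaled-step n {a} {b} na<nb+n = subst (a ≤_) (ℤP.pred-suc b)
  (ℤP.i<j⇒i≤pred[j] (ℤP.*-cancelˡ-<-nonNeg n (subst (n * a <_) factor na<nb+n)))
  where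
  factor : n * b + n ≡ n * (+ 1 + b)
  factor = solve (n ∷ b ∷ [])

≤-minus⇔ : ∀ {x y z} → z ≤ x - y ⇔ z + y ≤ x
≤-minus⇔ {x} {y} {z} = mk⇔ to from
  where
  to : z ≤ x - y → z + y ≤ x
  to z≤x-y = ≤-by (gap z≤x-y) (solve (x ∷ y ∷ z ∷ []))
  from : z + y ≤ x → z ≤ x - y
  from z+y≤x = ≤-by (gap z+y≤x) (solve (x ∷ y ∷ z ∷ []))

minus-≤⇔ : ∀ {x y z} → x - y ≤ z ⇔ x ≤ z + y
minus-≤⇔ {x} {y} {z} = mk⇔ to from
  where
  to : x - y ≤ z → x ≤ z + y
  to x-y≤z = ≤-by (gap x-y≤z) (solve (x ∷ y ∷ z ∷ []))
  from : x ≤ z + y → x - y ≤ z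
  from x≤z+y = ≤-by (gap x≤z+y) (solve (x ∷ y ∷ z ∷ []))

listSum : ∀ {X : Set} → List X → (X → ℤ) → ℤ
listSum xs f = foldr _+_ (+ 0) (map f xs)

listSum-cong : ∀ {X : Set} (xs : List X) {f g : X → ℤ} →
               (∀ x → f x ≡ g x) → listSum xs f ≡ listSum xs g
listSum-cong xs f≗g = cong (foldr _+_ (+ 0)) (map-cong f≗g xs)

listSum-affine : ∀ {X : Set} (xs : List X) k (g h : X → ℤ) →
  listSum xs (λ x → (k - g x) + h x) ≡ + length xs * k - listSum xs g + listSum xs h
listSum-affine []       k g h = solve (k ∷ [])
listSum-affine (x ∷ xs) k g h =
  trans (cong (λ s → (k - g x) + h x + s) (listSum-affine xs k g h))
        (regroup k (g x) (h x) (+ length xs) (listSum xs g) (listSum xs h))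
  where
  regroup : ∀ k a b L G H → (k - a) + b + (L * k - G + H) ≡ (+ 1 + L) * k - (a + G) + (b + H)
  regroup = solve-∀

indicator : ∀ {a} {A : Set a} → Dec A → ℤ
indicator d = if does d then + 1 else + 0

count-as-sum : ∀ {X : Set} (xs : List X) (f : X → ℕ) {ℓ} {Q : Pred ℕ ℓ} (Q? : Decidable Q) →
  + length (filter Q? (map f xs)) ≡ listSum xs (λ x → indicator (Q? (f x)))
count-as-sum []       f Q? = refl
count-as-sum (x ∷ xs) f Q? with Q? (f x)
... | yes _ = cong (λ n → + 1 + n) (count-as-sum xs f Q?)
... | no  _ = trans (count-as-sum xs f Q?) (sym (ℤP.+-identityˡ _))

count-complement : ∀ {X : Set} {P Q : Pred X 0ℓ} (P? : Decidable P) (Q? : Decidable Q) →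
  (∀ x → P x ⊎ Q x) → (∀ x → P x → ¬ Q x) →
  ∀ xs → length (filter P? xs) ℕ.+ length (filter Q? xs) ≡ length xs
count-complement P? Q? cover disjoint [] = refl
count-complement P? Q? cover disjoint (x ∷ xs) with P? x | Q? x | cover x
... | yes px | yes qx | _      = ⊥-elim (disjoint x px qx)
... | yes _  | no _   | _      = cong suc (count-complement P? Q? cover disjoint xs)
... | no _   | yes _  | _      =
  trans (ℕP.+-suc _ _) (cong suc (count-complement P? Q? cover disjoint xs))
... | no ¬px | no _   | inj₁ px = ⊥-elim (¬px px)
... | no _   | no ¬qx | inj₂ qx = ⊥-elim (¬qx qx)

complement-bound : ∀ {c b p j m} → c ℕ.+ b ≡ p → j ℕ.+ m ≡ 2 ℕ.* p →
                   (c ℕ.≤ j ⇔ m ℕ.≤ p ℕ.+ b)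
complement-bound {c} {b} {j = j} {m} refl j+m≡2p = mk⇔
  (λ c≤j → ℕP.+-cancelˡ-≤ c m (c ℕ.+ b ℕ.+ b) (begin
     c ℕ.+ m                 ≤⟨ ℕP.+-monoˡ-≤ m c≤j ⟩
     j ℕ.+ m                 ≡⟨ j+m≡2p ⟩
     2 ℕ.* (c ℕ.+ b)         ≡⟨ double c b ⟩
     c ℕ.+ (c ℕ.+ b ℕ.+ b)   ∎))
  (λ m≤p+b → ℕP.+-cancelʳ-≤ m c j (begin
     c ℕ.+ m                 ≤⟨ ℕP.+-monoʳ-≤ c m≤p+b ⟩
     c ℕ.+ (c ℕ.+ b ℕ.+ b)   ≡⟨ double c b ⟨
     2 ℕ.* (c ℕ.+ b)         ≡⟨ j+m≡2p ⟨
     j ℕ.+ m                 ∎))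
  where
  open ℕP.≤-Reasoning
  double : ∀ c b → 2 ℕ.* (c ℕ.+ b) ≡ c ℕ.+ (c ℕ.+ b ℕ.+ b)
  double = ℕSolver.solve-∀

module CeilingDivision (m : ℕ) .{{_ : NonZero m}} where
  open ℤP.≤-Reasoning

  ceil-upper : ∀ x → x ≤ + m * ceilDiv x m
  ceil-upper x = begin
    x                          ≡⟨ ℤP.neg-involutive x ⟨
    - - x                      ≤⟨ ℤP.neg-mono-≤ ([n/ℕd]*d≤n (- x) m) ⟩
    - ((- x /ℕ m) * + m)       ≡⟨ cong -_ (ℤP.*-comm (- x /ℕ m) (+ m)) ⟩
    - (+ m * (- x /ℕ m))       ≡⟨ ℤP.neg-distribʳ-* (+ m) (- x /ℕ m) ⟩
    + m * ceilDiv x m          ∎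

  ceil-least : ∀ x w → x ≤ + m * w → ceilDiv x m ≤ w
  ceil-least x w x≤mw = begin
    - f        ≤⟨ ℤP.neg-mono-≤ -w≤f ⟩
    - - w      ≡⟨ ℤP.neg-involutive w ⟩
    w          ∎
    where
    f = - x /ℕ m
    m*-w<m*[1+f] : + m * - w < + m * ℤ.suc f
    m*-w<m*[1+f] = begin-strict
      + m * - w       ≡⟨ ℤP.neg-distribʳ-* (+ m) w ⟨
      - (+ m * w)     ≤⟨ ℤP.neg-mono-≤ x≤mw ⟩
      - x             <⟨ n<s[n/ℕd]*d (- x) m ⟩
      ℤ.suc f * + m   ≡⟨ ℤP.*-comm (ℤ.suc f) (+ m) ⟩
      + m * ℤ.suc f   ∎
    -w≤f : - w ≤ f
    -w≤f = subst (- w ≤_) (ℤP.pred-suc f)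
             (ℤP.i<j⇒i≤pred[j] (ℤP.*-cancelˡ-<-nonNeg (+ m) m*-w<m*[1+f]))

  ceil-lower : ∀ x → + m * ceilDiv x m < x + + m
  ceil-lower x = <-by (strict-gap (n<s[n/ℕd]*d (- x) m)) (rearrange x (+ m) (- x /ℕ m))
    where
    rearrange : ∀ x m f → (x + m) - (+ 1 + m * - f) ≡ (+ 1 + f) * m - (+ 1 + - x)
    rearrange = solve-∀

-- ⌈r/N⌉ for a remainder 0 ≤ r < N.
step : ℕ → ℤ
step zero    = + 0
step (suc _) = + 1

module Core (P : ℤ) (1≤P : + 1 ≤ P) (q : ℤ → ℤ)
            (q-least : ∀ x w → x ≤ (P + P) * w → q x ≤ w)
            (q-upper : ∀ x → x ≤ (P + P) * q x)
            (q-lower : ∀ x → (P + P) * q x < x + (P + P)) where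

  0≤P : + 0 ≤ P
  0≤P = ℤP.≤-trans 0≤1 1≤P

  0<N : + 0 < P + P
  0<N = <-by (gap 1≤P ⊕ gap 1≤P ⊕ 0≤1) (solve (P ∷ []))

  1<N : + 1 < P + P
  1<N = <-by (gap 1≤P ⊕ gap 1≤P) (solve (P ∷ []))

  N*0≡0 : (P + P) * + 0 ≡ + 0
  N*0≡0 = ℤP.*-zeroʳ (P + P)

  N*1≡N : (P + P) * + 1 ≡ P + P
  N*1≡N = ℤP.*-identityʳ (P + P)

  instance
    N-nonNeg : ℤ.NonNegative (P + P)
    N-nonNeg = ℤ.nonNegative (ℤP.+-mono-≤ 0≤P 0≤P)

  q-exceeds : ∀ {x w} → (P + P) * w < x → w < q x
  q-exceeds {x} {w} Nw<x = ℤP.≰⇒> λ qx≤w →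
    ℤP.<⇒≱ Nw<x (ℤP.≤-trans (q-upper x) (ℤP.*-monoˡ-≤-nonNeg (P + P) qx≤w))

  q-≡ : ∀ {x v} → x ≤ (P + P) * v → (P + P) * v < x + (P + P) → q x ≡ v
  q-≡ {x} {v} x≤Nv Nv<x+N = ℤP.≤-antisym (q-least x v x≤Nv)
    (scaled-step (P + P) (ℤP.<-≤-trans Nv<x+N (ℤP.+-monoˡ-≤ (P + P) (q-upper x))))

  q-shift : ∀ d y → q ((P + P) * d + y) ≡ d + q y
  q-shift d y = q-≡ lower upper
    where
    open ℤP.≤-Reasoning
    lower : (P + P) * d + y ≤ (P + P) * (d + q y)
    lower = begin
      (P + P) * d + y              ≤⟨ ℤP.+-monoʳ-≤ ((P + P) * d) (q-upper y) ⟩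
      (P + P) * d + (P + P) * q y  ≡⟨ ℤP.*-distribˡ-+ (P + P) d (q y) ⟨
      (P + P) * (d + q y)          ∎
    upper : (P + P) * (d + q y) < (P + P) * d + y + (P + P)
    upper = begin-strict
      (P + P) * (d + q y)          ≡⟨ ℤP.*-distribˡ-+ (P + P) d (q y) ⟩
      (P + P) * d + (P + P) * q y  <⟨ ℤP.+-monoʳ-< ((P + P) * d) (q-lower y) ⟩
      (P + P) * d + (y + (P + P))  ≡⟨ ℤP.+-assoc ((P + P) * d) y (P + P) ⟨
      (P + P) * d + y + (P + P)    ∎

  q-zero : ∀ {x} → - (P + P) < x → x ≤ + 0 → q x ≡ + 0
  q-zero {x} -N<x x≤0 = q-≡ (≤-by (gap x≤0) (solve (P ∷ x ∷ [])))
                              (<-by (strict-gap -N<x) (solve (P ∷ x ∷ [])))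

  q-one : ∀ {x} → + 0 < x → x ≤ P + P → q x ≡ + 1
  q-one {x} 0<x x≤N = q-≡ (≤-by (gap x≤N) (solve (P ∷ x ∷ [])))
                          (<-by (strict-gap 0<x) (solve (P ∷ x ∷ [])))

  q-nonpos : ∀ {x} → q x ≡ + 0 → x ≤ + 0
  q-nonpos {x} qx≡0 = subst (x ≤_) (trans (cong ((P + P) *_) qx≡0) N*0≡0) (q-upper x)

  q0 : q (+ 0) ≡ + 0
  q0 = q-zero (ℤP.neg-mono-< 0<N) ℤP.≤-refl

  q-step : ∀ r → + r < P + P → q (+ r) ≡ step r
  q-step zero    _   = q0
  q-step (suc r) r<N = q-one (ℤ.+<+ (ℕ.s≤s ℕ.z≤n)) (ℤP.<⇒≤ r<N)

  q-remainder : ∀ k r → + r < P + P → q ((P + P) * k + + r) ≡ k + step r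
  q-remainder k r r<N = trans (q-shift k (+ r)) (cong (λ v → k + v) (q-step r r<N))

  q-diff-< : ∀ {x h} → h < x → x < P + P → + 0 ≤ h → q (x - h) ≡ + 1
  q-diff-< {x} {h} h<x x<N 0≤h =
    q-one (<-by (strict-gap h<x) (solve (x ∷ h ∷ [])))
          (≤-by (strict-gap x<N ⊕ gap 0≤h ⊕ 0≤1) (solve (P ∷ x ∷ h ∷ [])))

  q-diff-≥ : ∀ {x h} → x ≤ h → h < P + P → + 0 ≤ x → q (x - h) ≡ + 0
  q-diff-≥ {x} {h} x≤h h<N 0≤x =
    q-zero (<-by (strict-gap h<N ⊕ gap 0≤x) (solve (P ∷ x ∷ h ∷ [])))
           (≤-by (gap x≤h) (solve (x ∷ h ∷ [])))

  exactly-one : ∀ {x y α β} → q x + q y ≡ α + β + + 1 →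
                ((P + P) * α < x × y ≤ (P + P) * β) ⊎ (x ≤ (P + P) * α × (P + P) * β < y)
  exactly-one {x} {y} {α} {β} sum with x ℤP.≤? (P + P) * α | y ℤP.≤? (P + P) * β
  ... | yes x≤Nα | yes y≤Nβ =
    ⊥-elim (ℤP.<-irrefl sum (sum-below (q-least x α x≤Nα) (q-least y β y≤Nβ)))
  ... | yes x≤Nα | no  y≰Nβ = inj₂ (x≤Nα , ℤP.≰⇒> y≰Nβ)
  ... | no  x≰Nα | yes y≤Nβ = inj₁ (ℤP.≰⇒> x≰Nα , y≤Nβ)
  ... | no  x≰Nα | no  y≰Nβ =
    ⊥-elim (ℤP.<-irrefl (sym sum) (sum-above (q-exceeds (ℤP.≰⇒> x≰Nα)) (q-exceeds (ℤP.≰⇒> y≰Nβ))))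

  -- The recurrence after substituting n = N·k + r (0 ≤ r < N) and evaluating the
  -- inner sums: the outer arguments become P·k + A + F r and P·k + B + G r.
  Recurrence : ℤ → ℤ → (ℕ → ℤ) → (ℕ → ℤ) → Set
  Recurrence A B F G = ∀ k r → + r < P + P →
    k + step r ≡ q (P * k + A + F r) + q (P * k + B + G r)

  module _ {A B : ℤ} {F G : ℕ → ℤ} where

    recurrence-at : Recurrence A B F G → ∀ k r → + r < P + P → ∀ {x y} →
                    P * k + A + F r ≡ x → P * k + B + G r ≡ y → k + step r ≡ q x + q y
    recurrence-at R k r r<N refl refl = R k r r<N

    swap : Recurrence A B F G → Recurrence B A G F
    swap R k r r<N = trans (R k r r<N) (ℤP.+-comm (q (P * k + A + F r)) (q (P * k + B + G r)))

    translate : ∀ d → Recurrence A B F G → Recurrence (A + (P + P) * d) (B - (P + P) * d) F G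
    translate d R k r r<N = begin
      k + step r                        ≡⟨ R k r r<N ⟩
      q X + q Y                         ≡⟨ cancel-shifts d (q X) (q Y) ⟩
      (d + q X) + (- d + q Y)           ≡⟨ cong₂ _+_ (q-shift d X) (q-shift (- d) Y) ⟨
      q ((P + P) * d + X) + q ((P + P) * - d + Y)
        ≡⟨ cong₂ (λ x y → q x + q y) (regroup P k A d (F r)) (regroup⁻ P k B d (G r)) ⟩
      q (P * k + (A + (P + P) * d) + F r) + q (P * k + (B - (P + P) * d) + G r) ∎
      where
      open ≡-Reasoning
      X = P * k + A + F r
      Y = P * k + B + G r
      cancel-shifts : ∀ d a b → a + b ≡ (d + a) + (- d + b)
      cancel-shifts = solve-∀
      regroup : ∀ h k a d f → (h + h) * d + (h * k + a + f) ≡ h * k + (a + (h + h) * d) + f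
      regroup = solve-∀
      regroup⁻ : ∀ h k b d g → (h + h) * - d + (h * k + b + g) ≡ h * k + (b - (h + h) * d) + g
      regroup⁻ = solve-∀

    -- Shifting k by 2 shifts both arguments by N, so rows k = 0 and k = 1 suffice.
    from-rows : (∀ e r → e ℕ.< 2 → + r < P + P →
                   + e + step r ≡ q (P * + e + A + F r) + q (P * + e + B + G r)) →
                Recurrence A B F G
    from-rows rows k r r<N = begin
      k + step r                        ≡⟨ cong (λ k → k + step r) k≡e+2m ⟩
      (+ e + m * + 2) + step r          ≡⟨ split (+ e) m (step r) ⟩
      (m + m) + (+ e + step r)          ≡⟨ cong (λ s → (m + m) + s) (rows e r (n%ℕd<d k 2) r<N) ⟩
      (m + m) + (q X + q Y)             ≡⟨ distribute m (q X) (q Y) ⟩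
      (m + q X) + (m + q Y)             ≡⟨ cong₂ _+_ (q-shift m X) (q-shift m Y) ⟨
      q ((P + P) * m + X) + q ((P + P) * m + Y)
        ≡⟨ cong₂ (λ x y → q x + q y) (regroup P (+ e) m A (F r)) (regroup P (+ e) m B (G r)) ⟩
      q (P * (+ e + m * + 2) + A + F r) + q (P * (+ e + m * + 2) + B + G r)
        ≡⟨ cong (λ k → q (P * k + A + F r) + q (P * k + B + G r)) k≡e+2m ⟨
      q (P * k + A + F r) + q (P * k + B + G r) ∎
      where
      open ≡-Reasoning
      e = k %ℕ 2
      m = k /ℕ 2
      k≡e+2m : k ≡ + e + m * + 2
      k≡e+2m = a≡a%ℕn+[a/ℕn]*n k 2
      X = P * + e + A + F r
      Y = P * + e + B + G r
      split : ∀ e m s → (e + m * + 2) + s ≡ (m + m) + (e + s)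
      split = solve-∀
      distribute : ∀ m a b → (m + m) + (a + b) ≡ (m + a) + (m + b)
      distribute = solve-∀
      regroup : ∀ h e m a f → (h + h) * m + (h * e + a + f) ≡ h * (e + m * + 2) + a + f
      regroup = solve-∀

  exactly-one-of-1 : ∀ {x y} → q x + q y ≡ + 1 → (+ 0 < x × y ≤ + 0) ⊎ (x ≤ + 0 × + 0 < y)
  exactly-one-of-1 {x} {y} sum with exactly-one {α = + 0} {β = + 0} sum
  ... | inj₁ (N0<x , y≤N0) = inj₁ (subst (_< x) N*0≡0 N0<x , subst (y ≤_) N*0≡0 y≤N0)
  ... | inj₂ (x≤N0 , N0<y) = inj₂ (subst (x ≤_) N*0≡0 x≤N0 , subst (_< y) N*0≡0 N0<y)

  exactly-one-of-2 : ∀ {x y} → q x + q y ≡ + 2 → (P + P < x × y ≤ + 0) ⊎ (x ≤ P + P × + 0 < y)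
  exactly-one-of-2 {x} {y} sum with exactly-one {α = + 1} {β = + 0} sum
  ... | inj₁ (N1<x , y≤N0) = inj₁ (subst (_< x) N*1≡N N1<x , subst (y ≤_) N*0≡0 y≤N0)
  ... | inj₂ (x≤N1 , N0<y) = inj₂ (subst (x ≤_) N*1≡N x≤N1 , subst (_< y) N*0≡0 N0<y)

  -- F records the inner sums of the recurrence: F 0 = 0 and r - P ≤ F r ≤ r.
  Admissible : (ℕ → ℤ) → Set
  Admissible F = F 0 ≡ + 0 × (∀ r → + r - P ≤ F r × F r ≤ + r)

  -- The residue conditions (1)/(2) in terms of F: 1 ≤ F r ≤ P for 0 < r < N.
  Good : (ℕ → ℤ) → Set
  Good F = ∀ r → + suc r < P + P → + 1 ≤ F (suc r) × F (suc r) ≤ P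

  Shape : ℤ → ℤ → Set
  Shape A B = ∃ λ d → (A ≡ (P + P) * d × B ≡ - ((P + P) * d) - P)
                    ⊎ (A ≡ - ((P + P) * d) - P × B ≡ (P + P) * d)

  within-P : ∀ {F G} → Admissible F → Admissible G → ∀ r → F r ≤ G r + P
  within-P (_ , boundsF) (_ , boundsG) r = ≤-via (proj₂ (boundsF r)) (proj₁ (boundsG r))

  row₀-arg : ∀ a f → P * + 0 + a + f ≡ a + f
  row₀-arg a f = solve (P ∷ a ∷ f ∷ [])

  row₁-arg : ∀ a f → P * + 1 + a + f ≡ P + a + f
  row₁-arg a f = solve (P ∷ a ∷ f ∷ [])

  q-pos : ∀ {f} → + 1 ≤ f → f ≤ P → q f ≡ + 1
  q-pos {f} 1≤f f≤P = q-one (ℤP.suc[i]≤j⇒i<j 1≤f) (≤-by (gap f≤P ⊕ gap 1≤P ⊕ 0≤1) (solve (P ∷ f ∷ [])))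

  q-below-P : ∀ {g} → + 0 ≤ g → g ≤ P → q (g - P) ≡ + 0
  q-below-P {g} 0≤g g≤P = q-zero (<-by (gap 0≤g ⊕ gap 1≤P) (solve (P ∷ g ∷ [])))
                                 (≤-by (gap g≤P) (solve (P ∷ g ∷ [])))

  q-above-P : ∀ {f} → + 0 ≤ f → f ≤ P → q (P + f) ≡ + 1
  q-above-P {f} 0≤f f≤P = q-one (<-by (gap 0≤f ⊕ gap 1≤P) (solve (P ∷ f ∷ [])))
                                (≤-by (gap f≤P) (solve (P ∷ f ∷ [])))

  -- Rows k = 0, 1 at a fixed r > 0 of the normalised recurrence pin both values into
  -- [1, P]: in row 0 only f can exceed 0 (as g - P ≤ f), in row 1 only g (as f - P ≤ g).
  pin-values : ∀ {f g} → f ≤ g + P → g ≤ f + P →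
               q f + q (g - P) ≡ + 1 → q (P + f) + q g ≡ + 2 →
               (+ 1 ≤ f × f ≤ P) × (+ 1 ≤ g × g ≤ P)
  pin-values {f} {g} f≤g+P g≤f+P row₀ row₁ with exactly-one-of-1 row₀ | exactly-one-of-2 row₁
  ... | inj₂ (f≤0 , 0<g-P) | _ =
    impossible (gap f≤0 ⊕ strict-gap 0<g-P ⊕ gap g≤f+P) (solve (P ∷ f ∷ g ∷ []))
  ... | _ | inj₁ (N<P+f , g≤0) =
    impossible (strict-gap N<P+f ⊕ gap g≤0 ⊕ gap f≤g+P) (solve (P ∷ f ∷ g ∷ []))
  ... | inj₁ (0<f , g-P≤0) | inj₂ (P+f≤N , 0<g) =
      (≤-by (strict-gap 0<f) (solve (P ∷ f ∷ [])) , ≤-by (gap P+f≤N) (solve (P ∷ f ∷ [])))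
    , (≤-by (strict-gap 0<g) (solve (P ∷ g ∷ [])) , ≤-by (gap g-P≤0) (solve (P ∷ g ∷ [])))

  module _ {F G : ℕ → ℤ} where

    NormalRows : Set
    NormalRows = ∀ r → + r < P + P →
      (step r ≡ q (F r) + q (G r - P)) × (+ 1 + step r ≡ q (P + F r) + q (G r))

    normal-rows : Recurrence (+ 0) (- P) F G ⇔ NormalRows
    normal-rows = mk⇔ to from
      where
      arg₀ᶠ : ∀ f → P * + 0 + + 0 + f ≡ f
      arg₀ᶠ f = solve (P ∷ f ∷ [])
      arg₀ᵍ : ∀ g → P * + 0 + - P + g ≡ g - P
      arg₀ᵍ g = solve (P ∷ g ∷ [])
      arg₁ᶠ : ∀ f → P * + 1 + + 0 + f ≡ P + f
      arg₁ᶠ f = solve (P ∷ f ∷ [])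
      arg₁ᵍ : ∀ g → P * + 1 + - P + g ≡ g
      arg₁ᵍ g = solve (P ∷ g ∷ [])

      to : Recurrence (+ 0) (- P) F G → NormalRows
      to R r r<N =
          trans (sym (ℤP.+-identityˡ (step r)))
                (recurrence-at R (+ 0) r r<N (arg₀ᶠ (F r)) (arg₀ᵍ (G r)))
        , recurrence-at R (+ 1) r r<N (arg₁ᶠ (F r)) (arg₁ᵍ (G r))

      from : NormalRows → Recurrence (+ 0) (- P) F G
      from rows = from-rows λ where
        zero r _ r<N → trans (ℤP.+-identityˡ (step r))
          (trans (proj₁ (rows r r<N)) (sym (cong₂ (λ x y → q x + q y) (arg₀ᶠ (F r)) (arg₀ᵍ (G r)))))
        (suc zero) r _ r<N →
          trans (proj₂ (rows r r<N)) (sym (cong₂ (λ x y → q x + q y) (arg₁ᶠ (F r)) (arg₁ᵍ (G r))))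
        (suc (suc _)) _ (ℕ.s≤s (ℕ.s≤s ())) _

    normal-good : Admissible F → Admissible G → Recurrence (+ 0) (- P) F G → Good F × Good G
    normal-good adF adG R = (λ r r<N → proj₁ (pinned r r<N)) , (λ r r<N → proj₂ (pinned r r<N))
      where
      pinned : ∀ r → + suc r < P + P →
               (+ 1 ≤ F (suc r) × F (suc r) ≤ P) × (+ 1 ≤ G (suc r) × G (suc r) ≤ P)
      pinned r r<N = pin-values (within-P adF adG (suc r)) (within-P adG adF (suc r))
                                (sym row₀) (sym row₁)
        where
        row₀ = proj₁ (Equivalence.to normal-rows R (suc r) r<N)
        row₁ = proj₂ (Equivalence.to normal-rows R (suc r) r<N)

    good-normal : Admissible F → Admissible G → Good F → Good G → Recurrence (+ 0) (- P) F G
    good-normal (F0 , _) (G0 , _) goodF goodG = Equivalence.from normal-rows rows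
      where
      rows : NormalRows
      rows zero _ rewrite F0 | G0 =
        sym (cong₂ _+_ q0 (q-below-P ℤP.≤-refl 0≤P)) , sym (cong₂ _+_ (q-above-P ℤP.≤-refl 0≤P) q0)
      rows (suc r) r<N with goodF r r<N | goodG r r<N
      ... | 1≤f , f≤P | 1≤g , g≤P =
          sym (cong₂ _+_ (q-pos 1≤f f≤P) (q-below-P (ℤP.≤-trans 0≤1 1≤g) g≤P))
        , sym (cong₂ _+_ (q-above-P (ℤP.≤-trans 0≤1 1≤f) f≤P) (q-pos 1≤g g≤P))

  second-too-large : ∀ {B g} → + 0 < B + g → g ≤ + 1 → P + B ≤ + 0 → ⊥
  second-too-large {B} {g} 0<B+g g≤1 P+B≤0 =
    impossible (strict-gap 0<B+g ⊕ gap g≤1 ⊕ gap 1≤P ⊕ gap P+B≤0) (solve (P ∷ B ∷ g ∷ []))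

  first-too-large : ∀ {A f} → P + P < P + A + f → A ≤ + 0 → f ≤ + 1 → ⊥
  first-too-large {A} {f} N<P+A+f A≤0 f≤1 =
    impossible (strict-gap N<P+A+f ⊕ gap A≤0 ⊕ gap f≤1 ⊕ gap 1≤P) (solve (P ∷ A ∷ f ∷ []))

  nonneg-from-sum : ∀ {a f} → + 0 < a + f → f ≤ + 1 → + 0 ≤ a
  nonneg-from-sum {a} {f} 0<a+f f≤1 = ≤-by (strict-gap 0<a+f ⊕ gap f≤1) (solve (a ∷ f ∷ []))

  -- The arithmetic of normal-offsets, for the values f = F 1 ≤ 1 and g = G 1 ≤ 1:
  -- in row (0, 1) only A + f can exceed 0, in row (1, 1) only P + B + g can.
  pin-offsets : ∀ {A B f g} → A ≤ + 0 → P + B ≤ + 0 → f ≤ + 1 → g ≤ + 1 →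
                q (A + f) + q (B + g) ≡ + 1 → q (P + A + f) + q (P + B + g) ≡ + 2 →
                A ≡ + 0 × B ≡ - P
  pin-offsets {A} {B} A≤0 P+B≤0 f≤1 g≤1 row₀ row₁
    with exactly-one-of-1 row₀ | exactly-one-of-2 row₁
  ... | inj₂ (_ , 0<B+g) | _ = ⊥-elim (second-too-large 0<B+g g≤1 P+B≤0)
  ... | _ | inj₁ (N<P+A+f , _) = ⊥-elim (first-too-large N<P+A+f A≤0 f≤1)
  ... | inj₁ (0<A+f , _) | inj₂ (_ , 0<P+B+g) =
      ℤP.≤-antisym A≤0 (nonneg-from-sum {a = A} 0<A+f f≤1)
    , ℤP.≤-antisym (≤-by (gap P+B≤0) (solve (P ∷ B ∷ [])))
                   (≤-by (nonneg-from-sum {a = P + B} 0<P+B+g g≤1) (solve (P ∷ B ∷ [])))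

  untranslate₁ : ∀ {A B u} → A + (P + P) * - u ≡ + 0 → B - (P + P) * - u ≡ - P →
                 A ≡ (P + P) * u × B ≡ - ((P + P) * u) - P
  untranslate₁ {A} {B} {u} A'≡0 B'≡-P = (begin
      A                                   ≡⟨ solve (P ∷ A ∷ u ∷ []) ⟩
      (A + (P + P) * - u) + (P + P) * u   ≡⟨ cong (_+ (P + P) * u) A'≡0 ⟩
      + 0 + (P + P) * u                   ≡⟨ ℤP.+-identityˡ ((P + P) * u) ⟩
      (P + P) * u                         ∎) , (begin
      B                                   ≡⟨ solve (P ∷ B ∷ u ∷ []) ⟩
      (B - (P + P) * - u) - (P + P) * u   ≡⟨ cong (_- (P + P) * u) B'≡-P ⟩
      - P - (P + P) * u                   ≡⟨ solve (P ∷ u ∷ []) ⟩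
      - ((P + P) * u) - P                 ∎)
    where open ≡-Reasoning

  untranslate₂ : ∀ {A B u} → A + (P + P) * - u ≡ - P → B - (P + P) * - u ≡ + 0 →
                 A ≡ - ((P + P) * - u) - P × B ≡ (P + P) * - u
  untranslate₂ {A} {B} {u} A'≡-P B'≡0 = (begin
      A                                       ≡⟨ solve (P ∷ A ∷ u ∷ []) ⟩
      (A + (P + P) * - u) - (P + P) * - u     ≡⟨ cong (_- (P + P) * - u) A'≡-P ⟩
      - P - (P + P) * - u                     ≡⟨ ℤP.+-comm (- P) (- ((P + P) * - u)) ⟩
      - ((P + P) * - u) - P                   ∎) , (begin
      B                                       ≡⟨ solve (P ∷ B ∷ u ∷ []) ⟩
      (B - (P + P) * - u) + (P + P) * - u     ≡⟨ cong (_+ (P + P) * - u) B'≡0 ⟩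
      + 0 + (P + P) * - u                     ≡⟨ ℤP.+-identityˡ ((P + P) * - u) ⟩
      (P + P) * - u                           ∎)
    where open ≡-Reasoning

  module _ {A B : ℤ} {F G : ℕ → ℤ} where

    normal-offsets : Admissible F → Admissible G → Recurrence A B F G →
                    A ≤ + 0 → P + B ≤ + 0 → A ≡ + 0 × B ≡ - P
    normal-offsets (_ , boundsF) (_ , boundsG) R A≤0 P+B≤0 =
      pin-offsets A≤0 P+B≤0 (proj₂ (boundsF 1)) (proj₂ (boundsG 1))
        (sym (recurrence-at R (+ 0) 1 1<N (row₀-arg A (F 1)) (row₀-arg B (G 1))))
        (sym (recurrence-at R (+ 1) 1 1<N (row₁-arg A (F 1)) (row₁-arg B (G 1))))

  module _ {A B : ℤ} {F G : ℕ → ℤ} where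

    normal-shape : Admissible F → Admissible G → Recurrence A B F G → A ≤ + 0 → B ≤ + 0 →
                   (A ≡ + 0 × B ≡ - P) ⊎ (A ≡ - P × B ≡ + 0)
    normal-shape adF@(F0 , _) adG@(G0 , _) R A≤0 B≤0 with exactly-one-of-1 row₁₀
      where
      row₁₀ : q (P + A) + q (P + B) ≡ + 1
      row₁₀ = sym (recurrence-at R (+ 1) 0 0<N (at-zero A F0) (at-zero B G0))
        where
        at-zero : ∀ a {h} → h ≡ + 0 → P * + 1 + a + h ≡ P + a
        at-zero a h≡0 = trans (cong (λ h → P * + 1 + a + h) h≡0) (solve (P ∷ a ∷ []))
    ... | inj₁ (_ , P+B≤0) = inj₁ (normal-offsets adF adG R A≤0 P+B≤0)
    ... | inj₂ (P+A≤0 , _) with normal-offsets adG adF (swap R) B≤0 P+A≤0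
    ...   | B≡0 , A≡-P = inj₂ (A≡-P , B≡0)

  offset-0 : ∀ {X d} → X ≡ (P + P) * d → + 0 + (P + P) * d ≡ X
  offset-0 {X} {d} X≡ = trans (ℤP.+-identityˡ ((P + P) * d)) (sym X≡)

  offset-P : ∀ {X d} → X ≡ - ((P + P) * d) - P → - P - (P + P) * d ≡ X
  offset-P {X} {d} X≡ = trans (ℤP.+-comm (- P) (- ((P + P) * d))) (sym X≡)

  module _ {A B : ℤ} {F G : ℕ → ℤ} where

    -- Necessity: translating by -⌈A/N⌉ makes both offsets ≤ 0, after which
    -- normal-shape and normal-good apply.
    necessary : Admissible F → Admissible G → Recurrence A B F G → Good F × Good G × Shape A B
    necessary adF@(F0 , _) adG@(G0 , _) R = conclude (normal-shape adF adG R' (q-nonpos qA'≡0) (q-nonpos qB'≡0))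
      where
      u = q A
      A' = A + (P + P) * - u
      B' = B - (P + P) * - u
      R' : Recurrence A' B' F G
      R' = translate (- u) R
      qA'≡0 : q A' ≡ + 0
      qA'≡0 = begin
        q (A + (P + P) * - u)   ≡⟨ cong q (ℤP.+-comm A ((P + P) * - u)) ⟩
        q ((P + P) * - u + A)   ≡⟨ q-shift (- u) A ⟩
        - u + u                 ≡⟨ ℤP.+-inverseˡ u ⟩
        + 0                     ∎
        where open ≡-Reasoning
      at-zero : ∀ a {h} → h ≡ + 0 → P * + 0 + a + h ≡ a
      at-zero a h≡0 = trans (cong (λ h → P * + 0 + a + h) h≡0) (solve (P ∷ a ∷ []))
      qB'≡0 : q B' ≡ + 0
      qB'≡0 = begin
        q B'              ≡⟨ ℤP.+-identityˡ (q B') ⟨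
        + 0 + q B'        ≡⟨ cong (_+ q B') qA'≡0 ⟨
        q A' + q B'       ≡⟨ recurrence-at R' (+ 0) 0 0<N (at-zero A' F0) (at-zero B' G0) ⟨
        + 0               ∎
        where open ≡-Reasoning
      conclude : (A' ≡ + 0 × B' ≡ - P) ⊎ (A' ≡ - P × B' ≡ + 0) → Good F × Good G × Shape A B
      conclude (inj₁ (A'≡0 , B'≡-P)) =
        let goods = normal-good adF adG (subst₂ (λ a b → Recurrence a b F G) A'≡0 B'≡-P R')
        in proj₁ goods , proj₂ goods , u , inj₁ (untranslate₁ {A} {B} {u} A'≡0 B'≡-P)
      conclude (inj₂ (A'≡-P , B'≡0)) =
        let goods = normal-good adG adF (swap (subst₂ (λ a b → Recurrence a b F G) A'≡-P B'≡0 R'))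
        in proj₂ goods , proj₁ goods , - u , inj₂ (untranslate₂ {A} {B} {u} A'≡-P B'≡0)

    sufficient : Admissible F → Admissible G → Good F → Good G → Shape A B → Recurrence A B F G
    sufficient adF adG goodF goodG (d , inj₁ (A≡ , B≡)) =
      subst₂ (λ a b → Recurrence a b F G) (offset-0 {A} {d} A≡) (offset-P {B} {d} B≡)
             (translate d (good-normal adF adG goodF goodG))
    sufficient adF adG goodF goodG (d , inj₂ (A≡ , B≡)) =
      subst₂ (λ a b → Recurrence a b F G) (offset-P {A} {d} A≡) (offset-0 {B} {d} B≡)
             (swap (translate d (good-normal adG adF goodG goodF)))

    recurrence⇔ : Admissible F → Admissible G → Recurrence A B F G ⇔ (Good F × Good G × Shape A B)
    recurrence⇔ adF adG = mk⇔ (necessary adF adG) λ (goodF , goodG , shape) → sufficient adF adG goodF goodG shape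

module Theory (p : ℕ) .{{_ : NonZero p}} where

  instance
    2p≢0 : NonZero (2 ℕ.* p)
    2p≢0 = ℕP.m*n≢0 2 p

  2p≡p+p : 2 ℕ.* p ≡ p ℕ.+ p
  2p≡p+p = cong (p ℕ.+_) (ℕP.+-identityʳ p)

  2p≡N : + (2 ℕ.* p) ≡ + p + + p
  2p≡N = cong +_ 2p≡p+p

  open CeilingDivision (2 ℕ.* p)

  open Core (+ p) (ℤ.+≤+ (ℕ.>-nonZero⁻¹ p)) (H p)
    (λ x w x≤Nw → ceil-least x w (subst (λ n → x ≤ n * w) (sym 2p≡N) x≤Nw))
    (λ x → subst (λ n → x ≤ n * H p x) 2p≡N (ceil-upper x))
    (λ x → subst (λ n → n * H p x < x + n) 2p≡N (ceil-lower x))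

  division : ∀ n → n ≡ (+ p + + p) * (n /ℕ (2 ℕ.* p)) + + (n %ℕ (2 ℕ.* p))
  division n = trans (a≡a%ℕn+[a/ℕn]*n n (2 ℕ.* p))
                     (trans (cong (λ m → + r + k * m) 2p≡N) (reorder (+ r) k (+ p + + p)))
    where
    k = n /ℕ (2 ℕ.* p)
    r = n %ℕ (2 ℕ.* p)
    reorder : ∀ r k m → r + k * m ≡ m * k + r
    reorder = solve-∀

  <2p⇒<N : ∀ {r} → r ℕ.< 2 ℕ.* p → + r < + p + + p
  <2p⇒<N {r} r<2p = ℤ.+<+ (subst (r ℕ.<_) 2p≡p+p r<2p)

  <N⇒<2p : ∀ {r} → + r < + p + + p → r ℕ.< 2 ℕ.* p
  <N⇒<2p {r} r<N = subst (r ℕ.<_) (sym 2p≡p+p) (ℤP.drop‿+<+ r<N)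

  module Shifts (c : Fin p → ℕ) where

    ĉ : Fin p → ℕ
    ĉ i = zhat p (+ c i)

    c̄ : Fin p → ℤ
    c̄ i = zbar p (+ c i)

    ĉ<2p : ∀ i → ĉ i ℕ.< 2 ℕ.* p
    ĉ<2p i = n%ℕd<d (+ c i) (2 ℕ.* p)

    below : ℕ → ℕ
    below r = countWhere ĉ (λ x → suc x ℕ.≤? r)

    above : ℕ → ℕ
    above m = countWhere ĉ (λ x → m ℕ.≤? x)

    above+below : ∀ m → above m ℕ.+ below m ≡ p
    above+below m = trans (count-complement (m ℕ.≤?_) (λ x → suc x ℕ.≤? m) cover disjoint (map ĉ (allFin p)))
                          (trans (length-map ĉ (allFin p)) (length-tabulate {n = p} (λ i → i)))
      where
      cover : ∀ x → m ℕ.≤ x ⊎ x ℕ.< m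
      cover x with m ℕ.≤? x
      ... | yes m≤x = inj₁ m≤x
      ... | no  m≰x = inj₂ (ℕP.≰⇒> m≰x)
      disjoint : ∀ x → m ℕ.≤ x → ¬ x ℕ.< m
      disjoint x m≤x x<m = ℕP.<⇒≱ x<m m≤x

    below≤p : ∀ r → below r ℕ.≤ p
    below≤p r = subst (below r ℕ.≤_) (above+below r) (ℕP.m≤n+m (below r) (above r))

    below-0 : below 0 ≡ 0
    below-0 = cong length (filter-none (λ x → suc x ℕ.≤? 0) (All.universal (λ _ ()) (map ĉ (allFin p))))

    above-2p : above (2 ℕ.* p) ≡ 0
    above-2p = cong length (filter-none (2 ℕ.* p ℕ.≤?_)
                 (All.map⁺ (All.tabulate⁺ (λ i → ℕP.<⇒≱ (ĉ<2p i)))))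

    count-≤ : ∀ j → countWhere ĉ (λ x → x ℕ.≤? j) ≡ below (suc j)
    count-≤ j = cong length (filter-≐ (λ x → x ℕ.≤? j) (λ x → suc x ℕ.≤? suc j)
                                      (ℕ.s≤s , ℕ.s≤s⁻¹) (map ĉ (allFin p)))

    F : ℕ → ℤ
    F r = + r - + below r

    admissible : Admissible F
    admissible = cong (λ b → + 0 - + b) below-0 , λ r →
      ℤP.+-monoʳ-≤ (+ r) (ℤP.neg-mono-≤ (ℤ.+≤+ (below≤p r))) , ℤP.i-j≤i (+ r) (+ below r)

    -- ⌈(n - c_i)/N⌉ at n = N·k + r: quotients subtract, remainders contribute [ĉ_i < r].
    ceil-shifted : ∀ k r → + r < + p + + p → ∀ i →
      H p ((+ p + + p) * k + + r - + c i) ≡ (k - c̄ i) + indicator (suc (ĉ i) ℕ.≤? r)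
    ceil-shifted k r r<N i = begin
      H p ((+ p + + p) * k + + r - + c i)
        ≡⟨ cong (λ x → H p ((+ p + + p) * k + + r - x)) (division (+ c i)) ⟩
      H p ((+ p + + p) * k + + r - ((+ p + + p) * c̄ i + + ĉ i))
        ≡⟨ cong (H p) (regroup (+ p + + p) k (+ r) (c̄ i) (+ ĉ i)) ⟩
      H p ((+ p + + p) * (k - c̄ i) + (+ r - + ĉ i))
        ≡⟨ q-shift (k - c̄ i) (+ r - + ĉ i) ⟩
      (k - c̄ i) + H p (+ r - + ĉ i)
        ≡⟨ cong (λ v → (k - c̄ i) + v) remainder ⟩
      (k - c̄ i) + indicator (suc (ĉ i) ℕ.≤? r) ∎
      where
      open ≡-Reasoning
      regroup : ∀ n k r b h → n * k + r - (n * b + h) ≡ n * (k - b) + (r - h)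
      regroup = solve-∀
      remainder-by : (ĉ<r? : Dec (ĉ i ℕ.< r)) → H p (+ r - + ĉ i) ≡ indicator ĉ<r?
      remainder-by (yes ĉ<r) = q-diff-< (ℤ.+<+ ĉ<r) r<N (ℤ.+≤+ ℕ.z≤n)
      remainder-by (no  ĉ≮r) = q-diff-≥ (ℤ.+≤+ (ℕP.≮⇒≥ ĉ≮r)) (<2p⇒<N (ĉ<2p i)) (ℤ.+≤+ ℕ.z≤n)
      remainder : H p (+ r - + ĉ i) ≡ indicator (suc (ĉ i) ℕ.≤? r)
      remainder = remainder-by (suc (ĉ i) ℕ.≤? r)

    sum-ceil : ∀ k r → + r < + p + + p →
      ∑ (λ i → H p ((+ p + + p) * k + + r - + c i)) ≡ + p * k - ∑ c̄ + + below r
    sum-ceil k r r<N = begin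
      ∑ (λ i → H p ((+ p + + p) * k + + r - + c i))
        ≡⟨ listSum-cong (allFin p) (ceil-shifted k r r<N) ⟩
      listSum (allFin p) (λ i → (k - c̄ i) + indicator (suc (ĉ i) ℕ.≤? r))
        ≡⟨ listSum-affine (allFin p) k c̄ (λ i → indicator (suc (ĉ i) ℕ.≤? r)) ⟩
      + length (allFin p) * k - ∑ c̄ + listSum (allFin p) (λ i → indicator (suc (ĉ i) ℕ.≤? r))
        ≡⟨ cong₂ (λ m s → + m * k - ∑ c̄ + s) (length-tabulate {n = p} (λ i → i))
                 (sym (count-as-sum (allFin p) ĉ (λ x → suc x ℕ.≤? r))) ⟩
      + p * k - ∑ c̄ + + below r ∎
      where open ≡-Reasoning

    outer-arg : ∀ s k r → + r < + p + + p →
      (+ p + + p) * k + + r - + s - ∑ (λ i → H p ((+ p + + p) * k + + r - + c i))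
        ≡ + p * k + (- + s + ∑ c̄) + F r
    outer-arg s k r r<N =
      trans (cong (λ S → (+ p + + p) * k + + r - + s - S) (sum-ceil k r r<N))
            (rearrange (+ p) k (+ r) (+ s) (∑ c̄) (+ below r))
      where
      rearrange : ∀ h k r s S b → (h + h) * k + r - s - (h * k - S + b) ≡ h * k + (- s + S) + (r - b)
      rearrange = solve-∀

    BelowCond : Set
    BelowCond = ∀ r → 1 ℕ.≤ r → r ℕ.< 2 ℕ.* p → below r ℕ.< r × r ℕ.≤ p ℕ.+ below r

    good⇔below : Good F ⇔ BelowCond
    good⇔below = mk⇔ to from
      where
      to : Good F → BelowCond
      to good (suc r) _ r<2p with good r (<2p⇒<N r<2p)
      ... | 1≤F , F≤P = ℤP.drop‿+≤+ (Equivalence.to (≤-minus⇔ {+ suc r} {+ below (suc r)}) 1≤F)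
                      , ℤP.drop‿+≤+ (Equivalence.to (minus-≤⇔ {+ suc r} {+ below (suc r)}) F≤P)
      from : BelowCond → Good F
      from cond r r<N with cond (suc r) (ℕ.s≤s ℕ.z≤n) (<N⇒<2p r<N)
      ... | b<r , r≤p+b = Equivalence.from (≤-minus⇔ {+ suc r} {+ below (suc r)}) (ℤ.+≤+ b<r)
                        , Equivalence.from (minus-≤⇔ {+ suc r} {+ below (suc r)}) (ℤ.+≤+ r≤p+b)

    -- BelowCond is conditions (1)/(2): their first halves are the lower bounds for r ≤ p,
    -- their second halves (with r = 2p - j) the upper bounds for r > p; the remaining
    -- bounds hold automatically since 0 ≤ below r ≤ p.
    below⇔residue : BelowCond ⇔ ResidueCond p c
    below⇔residue = mk⇔ to from
      where
      p<2p : p ℕ.< 2 ℕ.* p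
      p<2p = subst (p ℕ.<_) (sym 2p≡p+p) (ℕP.m<m+n p (ℕ.>-nonZero⁻¹ p))

      to : BelowCond → ResidueCond p c
      to cond j j<p = subst (ℕ._≤ j) (sym (count-≤ j)) (ℕ.s≤s⁻¹ (proj₁ (cond (suc j) (ℕ.s≤s ℕ.z≤n) 1+j<2p)))
                    , above-bound j j<p
        where
        1+j<2p = ℕP.≤-<-trans j<p p<2p
        above-bound : ∀ j → j ℕ.< p → above (2 ℕ.* p ℕ.∸ j) ℕ.≤ j
        above-bound zero    _   = ℕP.≤-reflexive above-2p
        above-bound (suc j) j<p = Equivalence.from (complement-bound (above+below m) (ℕP.m+[n∸m]≡n j≤2p))
                                                   (proj₂ (cond m (ℕP.m<n⇒0<n∸m j<2p) m<2p))
          where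
          m = 2 ℕ.* p ℕ.∸ suc j
          j<2p = ℕP.<-trans j<p p<2p
          j≤2p = ℕP.<⇒≤ j<2p
          m<2p = ℕP.∸-monoʳ-< {o = 0} (ℕ.s≤s ℕ.z≤n) j≤2p

      from : ResidueCond p c → BelowCond
      from residue (suc r) _ r<2p with suc r ℕ.≤? p
      ... | yes r<p = ℕ.s≤s (subst (ℕ._≤ r) (count-≤ r) (proj₁ (residue r r<p)))
                    , ℕP.≤-trans r<p (ℕP.m≤m+n p (below (suc r)))
      ... | no  r≮p = ℕP.≤-<-trans (below≤p (suc r)) (ℕP.≰⇒> r≮p)
                    , Equivalence.to (complement-bound (above+below (suc r)) j+r≡2p) above≤j
        where
        j = 2 ℕ.* p ℕ.∸ suc r
        r≤2p = ℕP.<⇒≤ r<2p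
        j+r≡2p : j ℕ.+ suc r ≡ 2 ℕ.* p
        j+r≡2p = ℕP.m∸n+n≡m r≤2p
        j<p : j ℕ.< p
        j<p = ℕP.≰⇒> λ p≤j → ℕP.<-irrefl (sym (trans j+r≡2p 2p≡p+p)) (ℕP.+-mono-≤-< p≤j (ℕP.≰⇒> r≮p))
        above≤j : above (suc r) ℕ.≤ j
        above≤j = subst (λ m → above m ℕ.≤ j) (ℕP.m∸[m∸n]≡n r≤2p) (proj₂ (residue j j<p))
      from residue zero () _

    good⇔residue : Good F ⇔ ResidueCond p c
    good⇔residue = Composition.equivalence good⇔below below⇔residue

  offset : ℕ → (Fin p → ℕ) → ℤ
  offset s c = - + s + ∑ (λ i → zbar p (+ c i))

  satisfies⇔recurrence : ∀ s t a b →
    Satisfies p s t a b ⇔ Recurrence (offset s a) (offset t b) (Shifts.F a) (Shifts.F b)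
  satisfies⇔recurrence s t a b = mk⇔ to from
    where
    open ≡-Reasoning
    outer : ℤ → ℤ
    outer n = H p (n - + s - ∑ (λ i → H p (n - + a i))) + H p (n - + t - ∑ (λ i → H p (n - + b i)))

    outer-at : ∀ k r → + r < + p + + p → outer ((+ p + + p) * k + + r) ≡
      H p (+ p * k + offset s a + Shifts.F a r) + H p (+ p * k + offset t b + Shifts.F b r)
    outer-at k r r<N = cong₂ (λ x y → H p x + H p y) (Shifts.outer-arg a s k r r<N) (Shifts.outer-arg b t k r r<N)

    to : Satisfies p s t a b → Recurrence (offset s a) (offset t b) (Shifts.F a) (Shifts.F b)
    to sat k r r<N = begin
      k + step r                         ≡⟨ q-remainder k r r<N ⟨
      H p ((+ p + + p) * k + + r)        ≡⟨ sat ((+ p + + p) * k + + r) ⟩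
      outer ((+ p + + p) * k + + r)      ≡⟨ outer-at k r r<N ⟩
      H p (+ p * k + offset s a + Shifts.F a r) + H p (+ p * k + offset t b + Shifts.F b r) ∎

    from : Recurrence (offset s a) (offset t b) (Shifts.F a) (Shifts.F b) → Satisfies p s t a b
    from R n = begin
      H p n                              ≡⟨ cong (H p) (division n) ⟩
      H p ((+ p + + p) * k + + r)        ≡⟨ q-remainder k r r<N ⟩
      k + step r                         ≡⟨ R k r r<N ⟩
      H p (+ p * k + offset s a + Shifts.F a r) + H p (+ p * k + offset t b + Shifts.F b r)
                                         ≡⟨ outer-at k r r<N ⟨
      outer ((+ p + + p) * k + + r)      ≡⟨ cong outer (division n) ⟨
      outer n                            ∎
      where
      k = n /ℕ (2 ℕ.* p)
      r = n %ℕ (2 ℕ.* p)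
      r<N = <2p⇒<N (n%ℕd<d n (2 ℕ.* p))

  shape⇔ : ∀ {A B} → Shape A B ⇔ (∃ λ (d : ℤ) →
             ((A ≡ + (2 ℕ.* p) * d) × (B ≡ - (+ (2 ℕ.* p) * d) - + p))
           ⊎ ((A ≡ - (+ (2 ℕ.* p) * d) - + p) × (B ≡ + (2 ℕ.* p) * d)))
  shape⇔ {A} {B} = mk⇔ (subst ShapeFor (sym 2p≡N)) (subst ShapeFor 2p≡N)
    where
    ShapeFor : ℤ → Set
    ShapeFor n = ∃ λ (d : ℤ) → ((A ≡ n * d) × (B ≡ - (n * d) - + p))
                             ⊎ ((A ≡ - (n * d) - + p) × (B ≡ n * d))

  theorem : ∀ s t a b → Satisfies p s t a b
      ⇔ (ResidueCond p a × ResidueCond p b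
         × ∃ λ (d : ℤ) →
             ((- + s + ∑ (λ i → zbar p (+ a i)) ≡ + (2 ℕ.* p) * d)
              × (- + t + ∑ (λ i → zbar p (+ b i)) ≡ - (+ (2 ℕ.* p) * d) - + p))
           ⊎ ((- + s + ∑ (λ i → zbar p (+ a i)) ≡ - (+ (2 ℕ.* p) * d) - + p)
              × (- + t + ∑ (λ i → zbar p (+ b i)) ≡ + (2 ℕ.* p) * d)))
  theorem s t a b =
    Composition.equivalence (satisfies⇔recurrence s t a b)
      (Composition.equivalence (recurrence⇔ (Shifts.admissible a) (Shifts.admissible b))
        (Shifts.good⇔residue a ×-⇔ Shifts.good⇔residue b ×-⇔ shape⇔))

theorem5p3 : (p : ℕ) → .{{_ : NonZero p}} → (s t : ℕ) → (a b : Fin p → ℕ)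
    → (∀ i → 1 ℕ.≤ a i) → (∀ i → 1 ℕ.≤ b i)
    → Satisfies p s t a b
      ⇔ (ResidueCond p a × ResidueCond p b
         × ∃ λ (d : ℤ) →
             ((- + s + ∑ (λ i → zbar p (+ a i)) ≡ + (2 ℕ.* p) * d)
              × (- + t + ∑ (λ i → zbar p (+ b i)) ≡ - (+ (2 ℕ.* p) * d) - + p))
           ⊎ ((- + s + ∑ (λ i → zbar p (+ a i)) ≡ - (+ (2 ℕ.* p) * d) - + p)
              × (- + t + ∑ (λ i → zbar p (+ b i)) ≡ + (2 ℕ.* p) * d)))
theorem5p3 p s t a b _ _ = Theory.theorem p s t a b
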